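{- For every $m\geq 2$ there is an optimal $(3,m)$-graph for split reliability.
   Context: A graph has a finite vertex set and a finite multiset of edges (multiple edges allowed); an $(n,m)$-graph has $n$ vertices and $m$ edges. Each edge is independently operational with probability $p$, vertices always operational. For distinct terminals $s,t$, the split reliability $\mathrm{Sp}(G;s,t)$ is the probability that the operational spanning subgraph has exactly two components, one containing $s$, the other containing $t$. A connected $(n,m)$-graph $G$ with distinct terminals $s,t$ is an optimal $(n,m)$-graph if for every connected $(n,m)$-graph $H$, every pair of distinct vertices $s',t'$ of $H$, and every $p\in(0,1)$, $\mathrm{Sp}(G;s,t)\geq \mathrm{Sp}(H;s',t')$.
   Formalization: The edge probability $p\in(0,1)$ in the definition of an optimal graph ranges only over the rationals. -}

module Defs where

open import Data.Nat using (ℕ; zero; suc)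
open import Data.Fin using (Fin; _≟_)
open import Data.Bool using (Bool; true; false; _∧_; _∨_; not; if_then_else_)
open import Data.Product using (_×_; _,_; proj₁; proj₂)
open import Data.Vec using (Vec; []; _∷_; replicate; lookup)
open import Data.List using (List; []; _∷_; map; _++_; foldr)
open import Data.Rational using (ℚ; 0ℚ; 1ℚ; _+_; _*_; _-_)
open import Relation.Nullary.Decidable using (⌊_⌋)
open import Relation.Nullary using (¬_)
open import Relation.Binary.PropositionalEquality using (_≡_; _≢_)

-- An (n,m)-graph: vertex set Fin n, a multiset of exactly m edges
-- (given as a vector of endpoint pairs; multiple edges allowed), no loops.
record Graph (n m : ℕ) : Set where
  constructor mkGraph
  field
    edges    : Vec (Fin n × Fin n) m
    loopless : ∀ k → proj₁ (lookup edges k) ≢ proj₂ (lookup edges k)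
open Graph public

_==_ : ∀ {n} → Fin n → Fin n → Bool
x == y = ⌊ x ≟ y ⌋

-- does some operational edge join a vertex in R to y?
-- (S : Vec Bool m marks which edges are operational)
stepAny : ∀ {n m} → Vec (Fin n × Fin n) m → Vec Bool m → (Fin n → Bool) → Fin n → Bool
stepAny [] [] R y = false
stepAny ((u , v) ∷ es) (b ∷ S) R y =
  (b ∧ ((R u ∧ (v == y)) ∨ (R v ∧ (u == y)))) ∨ stepAny es S R y

reachWithin : ∀ {n m} → ℕ → Vec (Fin n × Fin n) m → Vec Bool m → Fin n → Fin n → Bool
reachWithin zero es S x y = x == y
reachWithin (suc k) es S x y =
  reachWithin k es S x y ∨ stepAny es S (reachWithin k es S x) y

-- connectivity in the operational spanning subgraph (walks of length ≤ n suffice)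
reach : ∀ {n m} → Graph n m → Vec Bool m → Fin n → Fin n → Bool
reach {n} G S x y = reachWithin n (edges G) S x y

allOn : ∀ {n m} → Graph n m → Vec Bool m
allOn {m = m} G = replicate m true

Connected : ∀ {n m} → Graph n m → Set
Connected G = ∀ x y → reach G (allOn G) x y ≡ true

-- the operational subgraph (edge state S) has exactly two components,
-- one containing s and the other containing t: s and t lie in different
-- components and every vertex lies in the component of s or that of t.
allFinB : ∀ n → (Fin n → Bool) → Bool
allFinB zero f = true
allFinB (suc n) f = f Fin.zero ∧ allFinB n (λ i → f (Fin.suc i))

splitB : ∀ {n m} → Graph n m → Vec Bool m → Fin n → Fin n → Bool
splitB {n} G S s t =
  not (reach G S s t) ∧ allFinB n (λ v → reach G S s v ∨ reach G S t v)

allStates : ∀ m → List (Vec Bool m)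
allStates zero = [] ∷ []
allStates (suc m) = map (true ∷_) (allStates m) ++ map (false ∷_) (allStates m)

-- probability of an edge state when each edge operates independently with prob. p
weight : ∀ {m} → ℚ → Vec Bool m → ℚ
weight p [] = 1ℚ
weight p (true ∷ S) = p * weight p S
weight p (false ∷ S) = (1ℚ - p) * weight p S

Sp : ∀ {n m} → Graph n m → Fin n → Fin n → ℚ → ℚ
Sp G s t p = foldr (λ S acc → (if splitB G S s t then weight p S else 0ℚ) + acc) 0ℚ (allStates _)

Optimal : ∀ {n m} → Graph n m → Fin n → Fin n → Set
Optimal {n} {m} G s t =
  Connected G × s ≢ t ×
  (∀ (H : Graph n m) (s′ t′ : Fin n) → Connected H → s′ ≢ t′ →
     ∀ (p : ℚ) → 0ℚ Data.Rational.< p → p Data.Rational.< 1ℚ →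
     Sp H s′ t′ p Data.Rational.≤ Sp G s t p)

{-# OPTIONS --safe #-}
-- Write q = 1 − p, and let G have three vertices: terminals s ≠ t and a third vertex w.
-- Reachability in the operational subgraph depends only on which of the pairs st, sw, tw
-- carry an operational edge, and checking the eight cases shows that G splits into the
-- components of s and t exactly when one of s, t has an operational incident edge and the
-- other has none.  Every edge touches s or t, so inclusion–exclusion gives
-- Sp = q^deg(s) + q^deg(t) − 2q^m.  If G is connected then deg(s), deg(t) ≥ 1 and
-- deg(s) + deg(t) ≥ m, and for such x, y we have q^x + q^y ≤ q + q^(x+y−1) ≤ q + q^(m−1),
-- the first step because the difference is q(1 − q^(x−1))(1 − q^(y−1)) ≥ 0.  The path
-- s – w – t whose w–t edge has multiplicity m − 1 has degrees 1 and m − 1, so it attains the bound.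
module Submission where

open import Algebra.Bundles using (CommutativeMonoid; CommutativeRing)
open import Data.Bool using (Bool; true; false; T; _∧_; _∨_; not; _xor_; if_then_else_)
import Data.Bool.Properties as Bool
open import Data.Fin using (Fin; zero; suc; _≟_; #_)
open import Data.Fin.Properties using (all?)
open import Data.List using (List; []; _∷_; map; _++_; foldr)
open import Data.Nat as ℕ using (ℕ; zero; suc; _≤_; z≤n; s≤s)
import Data.Nat.Properties as ℕ
open import Data.Product as Product using (_×_; _,_; proj₁; proj₂; ∃-syntax)
open import Data.Rational as ℚ using (ℚ; 0ℚ; 1ℚ; _+_; _*_; _-_; -_; nonNegative)
open import Data.Rational.Properties
  using ( +-identityˡ; +-identityʳ; +-assoc; +-inverseʳ; *-zeroʳ; *-identityʳ; *-distribˡ-+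
        ; +-*-commutativeRing; ≤-refl; ≤-trans; ≤-reflexive; <⇒≤; +-monoˡ-≤; +-monoʳ-≤
        ; neg-antimono-≤; *-monoˡ-≤-nonNeg; nonNeg*nonNeg⇒nonNeg; nonNegative⁻¹; module ≤-Reasoning )
open import Data.Rational.Solver using (module +-*-Solver)
open import Data.Sum as Sum using (_⊎_; inj₁; inj₂)
open import Data.Vec using (Vec; []; _∷_; lookup; replicate)
open import Data.Vec.Properties using (lookup-replicate)
open import Function using (_∘_; Equivalence)
open import Relation.Binary.PropositionalEquality
open import Relation.Nullary.Decidable using (Dec; T?; from-yes; toWitness; ¬?; _→-dec_; _×-dec_; map′)

open import Algebra.Properties.CommutativeSemigroup
  (CommutativeMonoid.commutativeSemigroup Bool.∨-commutativeMonoid) using (interchange)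
open import Algebra.Properties.Semiring.Exp
  (CommutativeRing.semiring +-*-commutativeRing) using (_^_; ^-homo-*)
open +-*-Solver using (solve; _:=_; _:+_; _:*_; _:-_; con)

open import Defs

private variable
  A : Set
  m n : ℕ

-- Probabilities of events on edge states

sumOver : (A → ℚ) → List A → ℚ
sumOver f = foldr (λ x acc → f x + acc) 0ℚ

sumOver-cong : ∀ {f g : A → ℚ} → (∀ x → f x ≡ g x) → ∀ xs → sumOver f xs ≡ sumOver g xs
sumOver-cong f≗g []       = refl
sumOver-cong f≗g (x ∷ xs) = cong₂ _+_ (f≗g x) (sumOver-cong f≗g xs)

sumOver-++ : ∀ (f : A → ℚ) xs ys → sumOver f (xs ++ ys) ≡ sumOver f xs + sumOver f ys
sumOver-++ f []       ys = sym (+-identityˡ _)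
sumOver-++ f (x ∷ xs) ys = trans (cong (f x +_) (sumOver-++ f xs ys)) (sym (+-assoc (f x) _ _))

sumOver-map : ∀ {B : Set} (f : B → ℚ) (g : A → B) xs → sumOver f (map g xs) ≡ sumOver (f ∘ g) xs
sumOver-map f g []       = refl
sumOver-map f g (x ∷ xs) = cong (f (g x) +_) (sumOver-map f g xs)

sumOver-+ : ∀ (f g : A → ℚ) xs → sumOver (λ x → f x + g x) xs ≡ sumOver f xs + sumOver g xs
sumOver-+ f g []       = refl
sumOver-+ f g (x ∷ xs) =
  trans (cong (f x + g x +_) (sumOver-+ f g xs))
        (solve 4 (λ a b c d → (a :+ b) :+ (c :+ d) := (a :+ c) :+ (b :+ d)) refl (f x) (g x) _ _)

sumOver-*ˡ : ∀ c (f : A → ℚ) xs → sumOver (λ x → c * f x) xs ≡ c * sumOver f xs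
sumOver-*ˡ c f []       = sym (*-zeroʳ c)
sumOver-*ˡ c f (x ∷ xs) = trans (cong (c * f x +_) (sumOver-*ˡ c f xs)) (sym (*-distribˡ-+ c (f x) _))

sumOver-zero : ∀ (xs : List A) → sumOver (λ _ → 0ℚ) xs ≡ 0ℚ
sumOver-zero []       = refl
sumOver-zero (x ∷ xs) = cong (0ℚ +_) (sumOver-zero xs)

-- By definition, Sp G s t p is prob p (λ S → splitB G S s t).
prob : ℚ → (Vec Bool m → Bool) → ℚ
prob {m} p E = sumOver (λ S → if E S then weight p S else 0ℚ) (allStates m)

prob-cong : ∀ p {E E′ : Vec Bool m → Bool} → (∀ S → E S ≡ E′ S) → prob p E ≡ prob p E′
prob-cong {m} p E≗E′ =
  sumOver-cong (λ S → cong (λ b → if b then weight p S else 0ℚ) (E≗E′ S)) (allStates m)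

if-*ˡ : ∀ b c x → (if b then c * x else 0ℚ) ≡ c * (if b then x else 0ℚ)
if-*ˡ true  c x = refl
if-*ˡ false c x = sym (*-zeroʳ c)

prob-∷ : ∀ p (E : Vec Bool (suc m) → Bool) →
  prob p E ≡ p * prob p (λ S → E (true ∷ S)) + (1ℚ - p) * prob p (λ S → E (false ∷ S))
prob-∷ {m} p E = begin
    prob p E
  ≡⟨ sumOver-++ f (map (true ∷_) states) (map (false ∷_) states) ⟩
    sumOver f (map (true ∷_) states) + sumOver f (map (false ∷_) states)
  ≡⟨ cong₂ _+_ (sumOver-map f (true ∷_) states) (sumOver-map f (false ∷_) states) ⟩
    sumOver (f ∘ (true ∷_)) states + sumOver (f ∘ (false ∷_)) states
  ≡⟨ cong₂ _+_ (scaled p (λ S → E (true ∷ S))) (scaled (1ℚ - p) (λ S → E (false ∷ S))) ⟩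
    p * prob p (λ S → E (true ∷ S)) + (1ℚ - p) * prob p (λ S → E (false ∷ S)) ∎
  where
  open ≡-Reasoning
  states : List (Vec Bool m)
  states = allStates m
  f : Vec Bool (suc m) → ℚ
  f S = if E S then weight p S else 0ℚ
  scaled : ∀ c (E′ : Vec Bool m → Bool) →
    sumOver (λ S → if E′ S then c * weight p S else 0ℚ) states ≡ c * prob p E′
  scaled c E′ = trans (sumOver-cong (λ S → if-*ˡ (E′ S) c (weight p S)) states) (sumOver-*ˡ c _ states)

prob-total : ∀ p (B E : Vec Bool m → Bool) →
  prob p E ≡ prob p (λ S → B S ∧ E S) + prob p (λ S → not (B S) ∧ E S)
prob-total {m} p B E =
  trans (sumOver-cong (λ S → indicator-split (B S) (E S) (weight p S)) (allStates m))
        (sumOver-+ (λ S → if B S ∧ E S then weight p S else 0ℚ)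
                   (λ S → if not (B S) ∧ E S then weight p S else 0ℚ) (allStates m))
  where
  indicator-split : ∀ b e x →
    (if e then x else 0ℚ) ≡ (if b ∧ e then x else 0ℚ) + (if not b ∧ e then x else 0ℚ)
  indicator-split true  e x = sym (+-identityʳ _)
  indicator-split false e x = sym (+-identityˡ _)

prob-xor : ∀ p (X Y : Vec Bool m → Bool) →
  prob p (λ S → X S xor Y S) ≡
    prob p (λ S → not (X S)) + prob p (λ S → not (Y S))
      - (prob p (λ S → not (X S ∨ Y S)) + prob p (λ S → not (X S ∨ Y S)))
prob-xor p X Y = begin
    prob p (λ S → X S xor Y S)
  ≡⟨ prob-total p X _ ⟩
    prob p (λ S → X S ∧ (X S xor Y S)) + prob p (λ S → not (X S) ∧ (X S xor Y S))
  ≡⟨ cong₂ _+_ (prob-cong p λ S → onlyX (X S) (Y S)) (prob-cong p λ S → onlyY (X S) (Y S)) ⟩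
    X∧¬Y + Y∧¬X
  ≡⟨ solve 3 (λ a b n → a :+ b := (b :+ n) :+ (a :+ n) :- (n :+ n)) refl X∧¬Y Y∧¬X N ⟩
    (Y∧¬X + N) + (X∧¬Y + N) - (N + N)
  ≡⟨ cong₂ (λ a b → a + b - (N + N)) (sym ¬X) (sym ¬Y) ⟩
    prob p (λ S → not (X S)) + prob p (λ S → not (Y S)) - (N + N) ∎
  where
  open ≡-Reasoning
  X∧¬Y Y∧¬X N : ℚ
  X∧¬Y = prob p (λ S → X S ∧ not (Y S))
  Y∧¬X = prob p (λ S → Y S ∧ not (X S))
  N = prob p (λ S → not (X S ∨ Y S))
  onlyX : ∀ x y → x ∧ (x xor y) ≡ x ∧ not y
  onlyX true  y = refl
  onlyX false y = refl
  onlyY : ∀ x y → not x ∧ (x xor y) ≡ y ∧ not x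
  onlyY true  y = sym (Bool.∧-zeroʳ y)
  onlyY false y = sym (Bool.∧-identityʳ y)
  neither : ∀ x y → not x ∧ not y ≡ not (x ∨ y)
  neither true  y = refl
  neither false y = refl
  ¬X : prob p (λ S → not (X S)) ≡ Y∧¬X + N
  ¬X = trans (prob-total p Y _) (cong (Y∧¬X +_) (prob-cong p λ S →
         trans (Bool.∧-comm (not (Y S)) (not (X S))) (neither (X S) (Y S))))
  ¬Y : prob p (λ S → not (Y S)) ≡ X∧¬Y + N
  ¬Y = trans (prob-total p X _) (cong (X∧¬Y +_) (prob-cong p λ S → neither (X S) (Y S)))

anyOperational : (A → Bool) → Vec A m → Vec Bool m → Bool
anyOperational P []       []      = false
anyOperational P (e ∷ es) (b ∷ S) = (b ∧ P e) ∨ anyOperational P es S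

count : (A → Bool) → Vec A m → ℕ
count P []       = 0
count P (e ∷ es) = if P e then suc (count P es) else count P es

anyOperational-cong : ∀ {P Q : A → Bool} (es : Vec A m) → (∀ k → P (lookup es k) ≡ Q (lookup es k)) →
  ∀ S → anyOperational P es S ≡ anyOperational Q es S
anyOperational-cong []       P≗Q []      = refl
anyOperational-cong (e ∷ es) P≗Q (b ∷ S) =
  cong₂ (λ x r → (b ∧ x) ∨ r) (P≗Q zero) (anyOperational-cong es (P≗Q ∘ suc) S)

anyOperational-∨ : ∀ (P Q : A → Bool) (es : Vec A m) S →
  anyOperational (λ e → P e ∨ Q e) es S ≡ anyOperational P es S ∨ anyOperational Q es S
anyOperational-∨ P Q []       []      = refl
anyOperational-∨ P Q (e ∷ es) (b ∷ S) =
  trans (cong₂ _∨_ (Bool.∧-distribˡ-∨ b (P e) (Q e)) (anyOperational-∨ P Q es S))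
        (interchange (b ∧ P e) (b ∧ Q e) (anyOperational P es S) (anyOperational Q es S))

anyOperational-∧ʳ : ∀ (P : A → Bool) c (es : Vec A m) S →
  anyOperational (λ e → P e ∧ c) es S ≡ anyOperational P es S ∧ c
anyOperational-∧ʳ P c []       []      = refl
anyOperational-∧ʳ P c (e ∷ es) (b ∷ S) =
  trans (cong₂ _∨_ (sym (Bool.∧-assoc b (P e) c)) (anyOperational-∧ʳ P c es S))
        (sym (Bool.∧-distribʳ-∨ c (b ∧ P e) _))

anyOperational⇒count : ∀ (P : A → Bool) (es : Vec A m) S → anyOperational P es S ≡ true → 1 ≤ count P es
anyOperational⇒count P []       []      ()
anyOperational⇒count P (e ∷ es) (b ∷ S) some with P e
... | true  = s≤s z≤n
... | false = anyOperational⇒count P es S (trans (cong (_∨ anyOperational P es S) (sym (Bool.∧-zeroʳ b))) some)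

count-all : ∀ (P : A → Bool) (es : Vec A m) → (∀ k → P (lookup es k) ≡ true) → count P es ≡ m
count-all P []       all = refl
count-all P (e ∷ es) all =
  trans (cong (λ b → if b then suc (count P es) else count P es) (all zero))
        (cong suc (count-all P es (all ∘ suc)))

count-∨ : ∀ (P Q : A → Bool) (es : Vec A m) → count (λ e → P e ∨ Q e) es ≤ count P es ℕ.+ count Q es
count-∨ P Q []       = z≤n
count-∨ P Q (e ∷ es) with P e | Q e | count-∨ P Q es
... | true  | true  | ih = s≤s (ℕ.≤-trans ih (ℕ.+-monoʳ-≤ (count P es) (ℕ.n≤1+n _)))
... | true  | false | ih = s≤s ih
... | false | true  | ih = ℕ.≤-trans (s≤s ih) (ℕ.≤-reflexive (sym (ℕ.+-suc (count P es) _)))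
... | false | false | ih = ih

count-replicate : ∀ (P : A → Bool) k e → count P (replicate k e) ≡ (if P e then k else 0)
count-replicate P zero    e with P e
... | true  = refl
... | false = refl
count-replicate P (suc k) e with P e | count-replicate P k e
... | true  | ih = cong suc ih
... | false | ih = ih

prob-noneOperational : ∀ p (P : A → Bool) (es : Vec A m) →
  prob p (λ S → not (anyOperational P es S)) ≡ (1ℚ - p) ^ count P es
prob-noneOperational p P []       = refl
prob-noneOperational {m = suc m} p P (e ∷ es) = begin
    prob p (λ S → not (anyOperational P (e ∷ es) S))
  ≡⟨ prob-∷ p (λ S → not (anyOperational P (e ∷ es) S)) ⟩
    p * prob p (λ S → not (P e ∨ anyOperational P es S)) + q * prob p (λ S → not (anyOperational P es S))
  ≡⟨ firstEdge (P e) ⟩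
    q ^ count P (e ∷ es) ∎
  where
  open ≡-Reasoning
  q : ℚ
  q = 1ℚ - p
  c : ℕ
  c = count P es
  firstEdge : ∀ b →
    p * prob p (λ S → not (b ∨ anyOperational P es S)) + q * prob p (λ S → not (anyOperational P es S))
      ≡ q ^ (if b then suc c else c)
  firstEdge true  =
    trans (cong₂ (λ z r → p * z + q * r) (sumOver-zero (allStates m)) (prob-noneOperational p P es))
          (solve 2 (λ p x → p :* con 0ℚ :+ (con 1ℚ :- p) :* x := (con 1ℚ :- p) :* x) refl p (q ^ c))
  firstEdge false =
    trans (cong (λ r → p * r + q * r) (prob-noneOperational p P es))
          (solve 2 (λ p x → p :* x :+ (con 1ℚ :- p) :* x := x) refl p (q ^ c))

incident : Fin n → Fin n × Fin n → Bool
incident x (u , v) = (u == x) ∨ (v == x)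

degree : Graph n m → Fin n → ℕ
degree G x = count (incident x) (edges G)

sameEnds : Fin n × Fin n → Fin n × Fin n → Bool
sameEnds (u , v) (x , y) = (u == x ∧ v == y) ∨ (u == y ∧ v == x)

sameEnds-sound : ∀ {u v x y : Fin n} → T (sameEnds (u , v) (x , y)) → (u ≡ x × v ≡ y) ⊎ (u ≡ y × v ≡ x)
sameEnds-sound same = Sum.map both both (Equivalence.to Bool.T-∨ same)
  where
  both : ∀ {a b c d : Fin n} → T (a == b ∧ c == d) → a ≡ b × c ≡ d
  both {a = a} {b} {c} {d} eqs =
    Product.map (toWitness {a? = a ≟ b}) (toWitness {a? = c ≟ d}) (Equivalence.to Bool.T-∧ eqs)

edgeStep : (Fin n → Bool) → Fin n → Fin n × Fin n → Bool
edgeStep R y (u , v) = (R u ∧ (v == y)) ∨ (R v ∧ (u == y))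

stepAny≡anyOperational : ∀ (es : Vec (Fin n × Fin n) m) S R y →
  stepAny es S R y ≡ anyOperational (edgeStep R y) es S
stepAny≡anyOperational []       []      R y = refl
stepAny≡anyOperational (e ∷ es) (b ∷ S) R y =
  cong ((b ∧ edgeStep R y e) ∨_) (stepAny≡anyOperational es S R y)

edgeStep-cong : ∀ {R R′ : Fin n → Bool} → (∀ x → R x ≡ R′ x) → ∀ y e → edgeStep R y e ≡ edgeStep R′ y e
edgeStep-cong R≗R′ y (u , v) = cong₂ (λ a b → (a ∧ (v == y)) ∨ (b ∧ (u == y))) (R≗R′ u) (R≗R′ v)

edgeStep-sameEnds : ∀ (R : Fin n → Bool) y {e e′} → T (sameEnds e e′) → edgeStep R y e ≡ edgeStep R y e′
edgeStep-sameEnds R y {u , v} {x , z} same with sameEnds-sound {u = u} {v} {x} {z} same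
... | inj₁ (refl , refl) = refl
... | inj₂ (refl , refl) = Bool.∨-comm (R u ∧ (v == y)) (R v ∧ (u == y))

allFinB-cong : ∀ n {f g : Fin n → Bool} → (∀ v → f v ≡ g v) → allFinB n f ≡ allFinB n g
allFinB-cong zero    f≗g = refl
allFinB-cong (suc n) f≗g = cong₂ _∧_ (f≗g zero) (allFinB-cong n (f≗g ∘ suc))

-- Three vertices

-- The catch-all clause also returns the junk value # 0 when s ≡ t.
third : Fin 3 → Fin 3 → Fin 3
third zero             (suc zero)       = # 2
third (suc zero)       zero             = # 2
third zero             (suc (suc zero)) = # 1
third (suc (suc zero)) zero             = # 1
third _                _                = # 0

-- Relative to terminals s, t and the third vertex w, a loopless edge joins s–t, s–w or t–w.
data EdgeType : Set where
  st sw tw : EdgeType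

_≡ᵇ_ : EdgeType → EdgeType → Bool
st ≡ᵇ st = true
sw ≡ᵇ sw = true
tw ≡ᵇ tw = true
_  ≡ᵇ _  = false

TypeSet : Set
TypeSet = Bool × Bool × Bool

singleton : EdgeType → TypeSet
singleton τ = τ ≡ᵇ st , τ ≡ᵇ sw , τ ≡ᵇ tw

-- stepTypes F and reachTypes k F are stepAny and reachWithin k for the graph
-- having one edge of each type recorded in F.
module _ (s t : Fin 3) where

  ends : EdgeType → Fin 3 × Fin 3
  ends st = s , t
  ends sw = s , third s t
  ends tw = t , third s t

  edgeType : Fin 3 × Fin 3 → EdgeType
  edgeType e = if sameEnds e (ends st) then st else if sameEnds e (ends sw) then sw else tw

  stepTypes : TypeSet → (Fin 3 → Bool) → Fin 3 → Bool
  stepTypes (a , b , c) R y =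
    (a ∧ edgeStep R y (ends st)) ∨ (b ∧ edgeStep R y (ends sw)) ∨ (c ∧ edgeStep R y (ends tw))

  stepTypes-cong : ∀ F {R R′ : Fin 3 → Bool} → (∀ x → R x ≡ R′ x) →
    ∀ y → stepTypes F R y ≡ stepTypes F R′ y
  stepTypes-cong (a , b , c) {R} {R′} R≗R′ y =
    cong₂ _∨_ (cong (a ∧_) (step st)) (cong₂ _∨_ (cong (b ∧_) (step sw)) (cong (c ∧_) (step tw)))
    where
    step : ∀ τ → edgeStep R y (ends τ) ≡ edgeStep R′ y (ends τ)
    step τ = edgeStep-cong R≗R′ y (ends τ)

  reachTypes : ℕ → TypeSet → Fin 3 → Fin 3 → Bool
  reachTypes zero    F x y = x == y
  reachTypes (suc k) F x y = reachTypes k F x y ∨ stepTypes F (reachTypes k F x) y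

  splitTypes : TypeSet → Bool
  splitTypes F = not (reachTypes 3 F s t) ∧ allFinB 3 (λ v → reachTypes 3 F s v ∨ reachTypes 3 F t v)

  present : EdgeType → Vec (Fin 3 × Fin 3) m → Vec Bool m → Bool
  present τ = anyOperational (λ e → edgeType e ≡ᵇ τ)

  operationalTypes : Vec (Fin 3 × Fin 3) m → Vec Bool m → TypeSet
  operationalTypes es S = present st es S , present sw es S , present tw es S

∀-Bool? : {P : Bool → Set} → (∀ b → Dec (P b)) → Dec (∀ b → P b)
∀-Bool? P? =
  map′ (λ (f , t) → λ { false → f ; true → t }) (λ h → h false , h true) (P? false ×-dec P? true)

sameEnds-edgeType : ∀ s t u v → s ≢ t → u ≢ v → T (sameEnds (u , v) (ends s t (edgeType s t (u , v))))
sameEnds-edgeType = from-yes (all? λ s → all? λ t → all? λ u → all? λ v →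
  ¬? (s ≟ t) →-dec ¬? (u ≟ v) →-dec
  T? (sameEnds (u , v) (ends s t (edgeType s t (u , v)))))

incident-s : ∀ s t u v → s ≢ t → u ≢ v →
  incident s (u , v) ≡ (edgeType s t (u , v) ≡ᵇ st) ∨ (edgeType s t (u , v) ≡ᵇ sw)
incident-s = from-yes (all? λ s → all? λ t → all? λ u → all? λ v →
  ¬? (s ≟ t) →-dec ¬? (u ≟ v) →-dec
  (incident s (u , v) Bool.≟ (edgeType s t (u , v) ≡ᵇ st) ∨ (edgeType s t (u , v) ≡ᵇ sw)))

incident-t : ∀ s t u v → s ≢ t → u ≢ v →
  incident t (u , v) ≡ (edgeType s t (u , v) ≡ᵇ st) ∨ (edgeType s t (u , v) ≡ᵇ tw)
incident-t = from-yes (all? λ s → all? λ t → all? λ u → all? λ v →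
  ¬? (s ≟ t) →-dec ¬? (u ≟ v) →-dec
  (incident t (u , v) Bool.≟ (edgeType s t (u , v) ≡ᵇ st) ∨ (edgeType s t (u , v) ≡ᵇ tw)))

reachTypes-s-t : ∀ s t → s ≢ t → ∀ a b c → reachTypes s t 3 (a , b , c) s t ≡ (a ∨ b) ∧ (a ∨ c)
reachTypes-s-t = from-yes (all? λ s → all? λ t → ¬? (s ≟ t) →-dec
  ∀-Bool? λ a → ∀-Bool? λ b → ∀-Bool? λ c →
  reachTypes s t 3 (a , b , c) s t Bool.≟ (a ∨ b) ∧ (a ∨ c))

splitTypes-xor : ∀ s t → s ≢ t → ∀ a b c → splitTypes s t (a , b , c) ≡ (a ∨ b) xor (a ∨ c)
splitTypes-xor = from-yes (all? λ s → all? λ t → ¬? (s ≟ t) →-dec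
  ∀-Bool? λ a → ∀-Bool? λ b → ∀-Bool? λ c →
  splitTypes s t (a , b , c) Bool.≟ (a ∨ b) xor (a ∨ c))

reachTypes-sw-tw : ∀ a x y → reachTypes (# 0) (# 1) 3 (a , true , true) x y ≡ true
reachTypes-sw-tw = from-yes (∀-Bool? λ a → all? λ x → all? λ y →
  reachTypes (# 0) (# 1) 3 (a , true , true) x y Bool.≟ true)

module _ (H : Graph 3 m) {s t : Fin 3} (s≢t : s ≢ t) where

  private
    es : Vec (Fin 3 × Fin 3) m
    es = edges H
    types : Vec Bool m → TypeSet
    types = operationalTypes s t es
    is : EdgeType → Fin 3 × Fin 3 → Bool
    is τ e = edgeType s t e ≡ᵇ τ
    has : EdgeType → Vec Bool m → Bool
    has τ = present s t τ es
    atS atT : Vec Bool m → Bool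
    atS = anyOperational (incident s) es
    atT = anyOperational (incident t) es

  edgeStep-edgeType : ∀ R y k →
    edgeStep R y (lookup es k) ≡ stepTypes s t (singleton (edgeType s t (lookup es k))) R y
  edgeStep-edgeType R y k =
    trans (edgeStep-sameEnds R y (sameEnds-edgeType s t _ _ s≢t (loopless H k)))
          (byType (edgeType s t (lookup es k)))
    where
    byType : ∀ τ → edgeStep R y (ends s t τ) ≡ stepTypes s t (singleton τ) R y
    byType st = sym (Bool.∨-identityʳ _)
    byType sw = sym (Bool.∨-identityʳ _)
    byType tw = refl

  stepAny≡stepTypes : ∀ S R y → stepAny es S R y ≡ stepTypes s t (types S) R y
  stepAny≡stepTypes S R y = begin
      stepAny es S R y
    ≡⟨ stepAny≡anyOperational es S R y ⟩
      anyOperational (edgeStep R y) es S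
    ≡⟨ anyOperational-cong es (edgeStep-edgeType R y) S ⟩
      anyOperational (λ e → (is st e ∧ E st) ∨ (is sw e ∧ E sw) ∨ (is tw e ∧ E tw)) es S
    ≡⟨ anyOperational-∨ (λ e → is st e ∧ E st) (λ e → (is sw e ∧ E sw) ∨ (is tw e ∧ E tw)) es S ⟩
      anyOperational (λ e → is st e ∧ E st) es S
        ∨ anyOperational (λ e → (is sw e ∧ E sw) ∨ (is tw e ∧ E tw)) es S
    ≡⟨ cong₂ _∨_ (anyOperational-∧ʳ (is st) (E st) es S)
                 (trans (anyOperational-∨ (λ e → is sw e ∧ E sw) (λ e → is tw e ∧ E tw) es S)
                        (cong₂ _∨_ (anyOperational-∧ʳ (is sw) (E sw) es S)
                                   (anyOperational-∧ʳ (is tw) (E tw) es S))) ⟩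
      stepTypes s t (types S) R y ∎
    where
    open ≡-Reasoning
    E : EdgeType → Bool
    E τ = edgeStep R y (ends s t τ)

  reachWithin≡reachTypes : ∀ S k x y → reachWithin k es S x y ≡ reachTypes s t k (types S) x y
  reachWithin≡reachTypes S zero    x y = refl
  reachWithin≡reachTypes S (suc k) x y =
    cong₂ _∨_ (reachWithin≡reachTypes S k x y)
      (trans (stepAny≡stepTypes S (reachWithin k es S x) y)
             (stepTypes-cong s t (types S) (reachWithin≡reachTypes S k x) y))

  atS≡ : ∀ S → atS S ≡ has st S ∨ has sw S
  atS≡ S = trans (anyOperational-cong es (λ k → incident-s s t _ _ s≢t (loopless H k)) S)
                 (anyOperational-∨ (is st) (is sw) es S)

  atT≡ : ∀ S → atT S ≡ has st S ∨ has tw S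
  atT≡ S = trans (anyOperational-cong es (λ k → incident-t s t _ _ s≢t (loopless H k)) S)
                 (anyOperational-∨ (is st) (is tw) es S)

  splitB≡xor : ∀ S → splitB H S s t ≡ atS S xor atT S
  splitB≡xor S = begin
      splitB H S s t
    ≡⟨ cong₂ (λ r c → not r ∧ c) (reach≡ s t) (allFinB-cong 3 λ v → cong₂ _∨_ (reach≡ s v) (reach≡ t v)) ⟩
      splitTypes s t (types S)
    ≡⟨ splitTypes-xor s t s≢t (has st S) (has sw S) (has tw S) ⟩
      (has st S ∨ has sw S) xor (has st S ∨ has tw S)
    ≡⟨ sym (cong₂ _xor_ (atS≡ S) (atT≡ S)) ⟩
      atS S xor atT S ∎
    where
    open ≡-Reasoning
    reach≡ : ∀ x y → reach H S x y ≡ reachTypes s t 3 (types S) x y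
    reach≡ = reachWithin≡reachTypes S 3

  reach-s-t : ∀ S → reach H S s t ≡ atS S ∧ atT S
  reach-s-t S = begin
      reach H S s t
    ≡⟨ reachWithin≡reachTypes S 3 s t ⟩
      reachTypes s t 3 (types S) s t
    ≡⟨ reachTypes-s-t s t s≢t (has st S) (has sw S) (has tw S) ⟩
      (has st S ∨ has sw S) ∧ (has st S ∨ has tw S)
    ≡⟨ sym (cong₂ _∧_ (atS≡ S) (atT≡ S)) ⟩
      atS S ∧ atT S ∎
    where open ≡-Reasoning

  incident-s-or-t : ∀ k → incident s (lookup es k) ∨ incident t (lookup es k) ≡ true
  incident-s-or-t k =
    trans (cong₂ _∨_ (incident-s s t _ _ s≢t (loopless H k)) (incident-t s t _ _ s≢t (loopless H k)))
          (covers (edgeType s t (lookup es k)))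
    where
    covers : ∀ τ → ((τ ≡ᵇ st) ∨ (τ ≡ᵇ sw)) ∨ ((τ ≡ᵇ st) ∨ (τ ≡ᵇ tw)) ≡ true
    covers st = refl
    covers sw = refl
    covers tw = refl

  Sp-formula : ∀ p →
    Sp H s t p ≡ (1ℚ - p) ^ degree H s + (1ℚ - p) ^ degree H t - ((1ℚ - p) ^ m + (1ℚ - p) ^ m)
  Sp-formula p = begin
      Sp H s t p
    ≡⟨ prob-cong p splitB≡xor ⟩
      prob p (λ S → atS S xor atT S)
    ≡⟨ prob-xor p atS atT ⟩
      prob p (λ S → not (atS S)) + prob p (λ S → not (atT S)) - (N + N)
    ≡⟨ cong₂ (λ a b → a + b - (N + N)) (prob-noneOperational p (incident s) es)
                                        (prob-noneOperational p (incident t) es) ⟩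
      q ^ degree H s + q ^ degree H t - (N + N)
    ≡⟨ cong (λ n → q ^ degree H s + q ^ degree H t - (n + n)) isolated ⟩
      q ^ degree H s + q ^ degree H t - (q ^ m + q ^ m) ∎
    where
    open ≡-Reasoning
    q N : ℚ
    q = 1ℚ - p
    N = prob p (λ S → not (atS S ∨ atT S))
    isolated : N ≡ q ^ m
    isolated = begin
        N
      ≡⟨ prob-cong p (λ S → cong not (sym (anyOperational-∨ (incident s) (incident t) es S))) ⟩
        prob p (λ S → not (anyOperational (λ e → incident s e ∨ incident t e) es S))
      ≡⟨ prob-noneOperational p (λ e → incident s e ∨ incident t e) es ⟩
        q ^ count (λ e → incident s e ∨ incident t e) es
      ≡⟨ cong (q ^_) (count-all _ es incident-s-or-t) ⟩
        q ^ m ∎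

  degree-sum : m ≤ degree H s ℕ.+ degree H t
  degree-sum = ℕ.≤-trans (ℕ.≤-reflexive (sym (count-all _ es incident-s-or-t)))
                         (count-∨ (incident s) (incident t) es)

  connected⇒degree-pos : Connected H → 1 ≤ degree H s × 1 ≤ degree H t
  connected⇒degree-pos conn =
    anyOperational⇒count (incident s) es (allOn H) (Bool.∧-conicalˡ (atS (allOn H)) (atT (allOn H)) s↝t) ,
    anyOperational⇒count (incident t) es (allOn H) (Bool.∧-conicalʳ (atS (allOn H)) (atT (allOn H)) s↝t)
    where
    s↝t : atS (allOn H) ∧ atT (allOn H) ≡ true
    s↝t = trans (sym (reach-s-t (allOn H))) (conn s t)

-- Powers of q ∈ [0, 1]

p≤q⇒0≤q-p : ∀ {p q} → p ℚ.≤ q → 0ℚ ℚ.≤ q - p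
p≤q⇒0≤q-p {p} p≤q = ≤-trans (≤-reflexive (sym (+-inverseʳ p))) (+-monoˡ-≤ (- p) p≤q)

0≤q⇒p≤p+q : ∀ p {q} → 0ℚ ℚ.≤ q → p ℚ.≤ p + q
0≤q⇒p≤p+q p 0≤q = ≤-trans (≤-reflexive (sym (+-identityʳ p))) (+-monoʳ-≤ p 0≤q)

0≤p*q : ∀ {p q} → 0ℚ ℚ.≤ p → 0ℚ ℚ.≤ q → 0ℚ ℚ.≤ p * q
0≤p*q {p} {q} 0≤p 0≤q =
  nonNegative⁻¹ _ {{nonNeg*nonNeg⇒nonNeg p {{nonNegative 0≤p}} q {{nonNegative 0≤q}}}}

module _ {q : ℚ} (0≤q : 0ℚ ℚ.≤ q) (q≤1 : q ℚ.≤ 1ℚ) where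

  ^-≤-1 : ∀ n → q ^ n ℚ.≤ 1ℚ
  ^-≤-1 zero    = ≤-refl
  ^-≤-1 (suc n) = begin
      q * q ^ n ≤⟨ *-monoˡ-≤-nonNeg q {{nonNegative 0≤q}} (^-≤-1 n) ⟩
      q * 1ℚ    ≡⟨ *-identityʳ q ⟩
      q         ≤⟨ q≤1 ⟩
      1ℚ        ∎
    where open ≤-Reasoning

  ^-antimono : m ≤ n → q ^ n ℚ.≤ q ^ m
  ^-antimono {n = n} z≤n = ^-≤-1 n
  ^-antimono (s≤s m≤n) = *-monoˡ-≤-nonNeg q {{nonNegative 0≤q}} (^-antimono m≤n)

  ^-suc+^-suc≤ : ∀ i j → q ^ suc i + q ^ suc j ℚ.≤ q ^ 1 + q ^ suc (i ℕ.+ j)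
  ^-suc+^-suc≤ i j = begin
      q ^ suc i + q ^ suc j
    ≤⟨ 0≤q⇒p≤p+q _ (0≤p*q 0≤q (0≤p*q (p≤q⇒0≤q-p (^-≤-1 i)) (p≤q⇒0≤q-p (^-≤-1 j)))) ⟩
      q ^ suc i + q ^ suc j + q * ((1ℚ - q ^ i) * (1ℚ - q ^ j))
    ≡⟨ solve 3 (λ q a b → q :* a :+ q :* b :+ q :* ((con 1ℚ :- a) :* (con 1ℚ :- b))
                          := q :* con 1ℚ :+ q :* (a :* b)) refl q (q ^ i) (q ^ j) ⟩
      q ^ 1 + q * (q ^ i * q ^ j)
    ≡⟨ cong (λ r → q ^ 1 + q * r) (sym (^-homo-* q i j)) ⟩
      q ^ 1 + q ^ suc (i ℕ.+ j) ∎
    where open ≤-Reasoning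

  ^+^≤ : ∀ {n x y} → 1 ≤ x → 1 ≤ y → suc (suc n) ≤ x ℕ.+ y →
    q ^ x + q ^ y ℚ.≤ q ^ 1 + q ^ suc n
  ^+^≤ {n} {suc i} {suc j} _ _ (s≤s n<i+1+j) = begin
      q ^ suc i + q ^ suc j     ≤⟨ ^-suc+^-suc≤ i j ⟩
      q ^ 1 + q ^ suc (i ℕ.+ j) ≤⟨ +-monoʳ-≤ (q ^ 1) (^-antimono (s≤s n≤i+j)) ⟩
      q ^ 1 + q ^ suc n         ∎
    where
    open ≤-Reasoning
    n≤i+j : n ≤ i ℕ.+ j
    n≤i+j = ℕ.≤-pred (ℕ.≤-trans n<i+1+j (ℕ.≤-reflexive (ℕ.+-suc i j)))

bundledPath : ∀ n → Graph 3 (suc (suc n))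
bundledPath n = mkGraph pathEdges pathLoopless
  where
  pathEdges : Vec (Fin 3 × Fin 3) (suc (suc n))
  pathEdges = (# 0 , # 2) ∷ replicate (suc n) (# 1 , # 2)
  pathLoopless : ∀ k → proj₁ (lookup pathEdges k) ≢ proj₂ (lookup pathEdges k)
  pathLoopless zero    ()
  pathLoopless (suc k) = subst (λ e → proj₁ e ≢ proj₂ e) (sym (lookup-replicate k (# 1 , # 2))) λ ()

bundledPath-degree-s : ∀ n → degree (bundledPath n) (# 0) ≡ 1
bundledPath-degree-s n = cong suc (count-replicate {A = Fin 3 × Fin 3} (incident (# 0)) (suc n) (# 1 , # 2))

bundledPath-degree-t : ∀ n → degree (bundledPath n) (# 1) ≡ suc n
bundledPath-degree-t n = count-replicate {A = Fin 3 × Fin 3} (incident (# 1)) (suc n) (# 1 , # 2)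

bundledPath-connected : ∀ n → Connected (bundledPath n)
bundledPath-connected n x y =
  trans (reachWithin≡reachTypes (bundledPath n) {# 0} {# 1} (λ ()) (allOn (bundledPath n)) 3 x y)
        (reachTypes-sw-tw (present (# 0) (# 1) st (edges (bundledPath n)) (allOn (bundledPath n))) x y)

bundledPath-optimal : ∀ n (H : Graph 3 (suc (suc n))) (s t : Fin 3) → Connected H → s ≢ t →
  ∀ p → 0ℚ ℚ.< p → p ℚ.< 1ℚ → Sp H s t p ℚ.≤ Sp (bundledPath n) (# 0) (# 1) p
bundledPath-optimal n H s t conn s≢t p 0<p p<1 = begin
    Sp H s t p
  ≡⟨ Sp-formula H s≢t p ⟩
    q ^ degree H s + q ^ degree H t - both
  ≤⟨ +-monoˡ-≤ (- both) (^+^≤ 0≤q q≤1 deg-s≥1 deg-t≥1 (degree-sum H s≢t)) ⟩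
    q ^ 1 + q ^ suc n - both
  ≡⟨ cong₂ (λ a b → q ^ a + q ^ b - both) (bundledPath-degree-s n) (bundledPath-degree-t n) ⟨
    q ^ degree (bundledPath n) (# 0) + q ^ degree (bundledPath n) (# 1) - both
  ≡⟨ Sp-formula (bundledPath n) {# 0} {# 1} (λ ()) p ⟨
    Sp (bundledPath n) (# 0) (# 1) p ∎
  where
  open ≤-Reasoning
  q both : ℚ
  q = 1ℚ - p
  both = q ^ suc (suc n) + q ^ suc (suc n)
  deg-s≥1 : 1 ≤ degree H s
  deg-s≥1 = proj₁ (connected⇒degree-pos H s≢t conn)
  deg-t≥1 : 1 ≤ degree H t
  deg-t≥1 = proj₂ (connected⇒degree-pos H s≢t conn)
  0≤q : 0ℚ ℚ.≤ q
  0≤q = p≤q⇒0≤q-p (<⇒≤ p<1)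
  q≤1 : q ℚ.≤ 1ℚ
  q≤1 = +-monoʳ-≤ 1ℚ (neg-antimono-≤ (<⇒≤ 0<p))

proposition2p6 : ∀ (m : ℕ) → 2 ≤ m →
    ∃[ G ] ∃[ s ] ∃[ t ] Optimal {3} {m} G s t
proposition2p6 (suc (suc n)) (s≤s (s≤s z≤n)) =
  bundledPath n , # 0 , # 1 , bundledPath-connected n , (λ ()) , bundledPath-optimal n
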